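{- Let $w:P\to Q$ be a morphism of $\mathbf{rPres}$ in $\mathcal W$, let $R,S$ be finite reflexive presentations, and let $i:R\to S$, $f:R\to P$, $g:S\to Q$ be morphisms with $w\circ f=g\circ i$. Then there exist countable reflexive presentations $P^\omega,Q^\omega$, a morphism $w^\omega:P^\omega\to Q^\omega$ in $\mathcal W$, and morphisms $f':R\to P^\omega$, $f'':P^\omega\to P$, $g':S\to Q^\omega$, $g'':Q^\omega\to Q$ such that $f=f''\circ f'$, $g=g''\circ g'$, $w^\omega\circ f'=g'\circ i$ and $w\circ f''=g''\circ w^\omega$.
   Context: A presentation $P$ consists of a set $P_1$ of generators and a set $P_2\subseteq P_1^*\times P_1^*$ of relations $u\Rightarrow v$ ($P_1^*$ the free monoid on $P_1$). $\overline P=P_1^*/{\sim_P}$ with $\sim_P$ the congruence generated by $P_2$. A morphism $f:P\to Q$ is a function $f:P_1\to Q_1$ with $f^*(u)\Rightarrow f^*(v)\in Q_2$ for all $u\Rightarrow v\in P_2$; it induces a monoid morphism $\overline f$. $P$ is reflexive if $u\Rightarrow u\in P_2$ for all $u\in P_1^*$; $\mathbf{rPres}$ is the category of reflexive presentations. A reflexive presentation is finite if it has finitely many generators and finitely many relations other than the reflexivity relations $u\Rightarrow u$ (equivalently, it is a finitely presentable object of $\mathbf{rPres}$); it is countable if $P_1$ is countable. $\mathcal W$ is the class of morphisms $f$ with $\overline f$ an isomorphism. -}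

module Defs where

open import Data.Nat using (ℕ)
open import Data.Fin using (Fin)
open import Data.List using (List; []; _∷_; _++_; map)
open import Data.List.Membership.Propositional using (_∈_)
open import Data.Product using (Σ; _×_; _,_)
open import Data.Sum using (_⊎_)
open import Function.Bundles using (_↔_; _↣_; _⇔_)
open import Relation.Binary.PropositionalEquality using (_≡_)

-- A presentation: a set of generators P₁ and a set of relations
-- P₂ ⊆ P₁* × P₁*, given as a predicate on pairs of words (words = lists).
record Pres : Set₁ where
  field
    Gen : Set
    Rel : List Gen → List Gen → Set
open Pres public

data _⊢_∼_ (P : Pres) : List (Gen P) → List (Gen P) → Set where
  gen   : ∀ {u v} → Rel P u v → P ⊢ u ∼ v
  ∼refl : ∀ {u} → P ⊢ u ∼ u
  ∼sym  : ∀ {u v} → P ⊢ u ∼ v → P ⊢ v ∼ u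
  ∼trans : ∀ {u v w} → P ⊢ u ∼ v → P ⊢ v ∼ w → P ⊢ u ∼ w
  ∼ctx  : ∀ x y {u v} → P ⊢ u ∼ v → P ⊢ (x ++ u ++ y) ∼ (x ++ v ++ y)

record Hom (P Q : Pres) : Set where
  field
    fun  : Gen P → Gen Q
    resp : ∀ u v → Rel P u v → Rel Q (map fun u) (map fun v)
open Hom public

_≈H_ : ∀ {P Q} → Hom P Q → Hom P Q → Set
f ≈H g = ∀ x → fun f x ≡ fun g x

_∘H_ : ∀ {P Q R} → Hom Q R → Hom P Q → Hom P R
_∘H_ {P} {Q} {R} g f = record
  { fun = λ x → fun g (fun f x)
  ; resp = λ u v r → subst₂ (Rel R) (sym (map-∘ u)) (sym (map-∘ v))
                       (resp g (map (fun f) u) (map (fun f) v) (resp f u v r)) }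
  where
  open import Data.List.Properties using (map-∘)
  open import Relation.Binary.PropositionalEquality using (subst₂; sym)

-- The induced map \overline f : \overline P → \overline Q is a monoid
-- isomorphism: there is an inverse monoid morphism
-- \overline Q → \overline P (maps on words respecting the congruences).
record IsIsoInduced {P Q : Pres} (f : Hom P Q) : Set where
  field
    inv      : List (Gen Q) → List (Gen P)
    inv-resp : ∀ {u v} → Q ⊢ u ∼ v → P ⊢ inv u ∼ inv v
    inv-unit : P ⊢ inv [] ∼ []
    inv-mult : ∀ u v → P ⊢ inv (u ++ v) ∼ (inv u ++ inv v)
    left     : ∀ u → P ⊢ inv (map (fun f) u) ∼ u
    right    : ∀ v → Q ⊢ map (fun f) (inv v) ∼ v

InW : ∀ {P Q} → Hom P Q → Set
InW f = IsIsoInduced f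

record RPres : Set₁ where
  field
    pres  : Pres
    isRefl : ∀ u → Rel pres u u
open RPres public

Finite : RPres → Set
Finite P = Σ ℕ (λ n → Gen (pres P) ↔ Fin n)
         × Σ (List (List (Gen (pres P)) × List (Gen (pres P))))
             (λ L → ∀ u v → Rel (pres P) u v ⇔ (u ≡ v ⊎ (u , v) ∈ L))

Countable : RPres → Set
Countable P = Gen (pres P) ↣ ℕ

module Submission where

-- Pω and Qω are generated by the union of an increasing sequence of finite
-- sets of generators of P and of Q, starting from the images of R and S.
-- Each stage adds, for every generator collected so far, the letters of the
-- witnesses that w̄ is an isomorphism on it: the derivations inv (w p) ∼ p in P
-- and w (inv q) ∼ q in Q, the words inv q, and the P-derivations showing that
-- inv respects each Q-relation occurring in them (and each relation of S).
-- Pω carries the relations of P pulled back along the inclusion and Qω those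
-- of Q that inv respects in Pω; every witness then lifts, so the restriction
-- wω of w induces an isomorphism, and countability holds because each stage
-- is finite.

open import Defs
open import Data.Empty using (⊥-elim)
open import Data.Fin using (Fin; toℕ)
open import Data.Fin.Properties using (toℕ-injective)
open import Data.List using (List; []; _∷_; _++_; [_]; map; concatMap; length; lookup; tabulate)
open import Data.List.Properties
  using (map-∘; map-cong; map-++; ++-identityʳ; concatMap-++; concatMap-cong; concatMap-map; map-concatMap)
open import Data.List.Membership.Propositional using (_∈_; mapWith∈)
open import Data.List.Membership.Propositional.Properties
  using (∈-++⁺ˡ; ∈-++⁺ʳ; ∈-concat⁺′; ∈-map⁺; ∈-tabulate⁺; ∈-lookup)
open import Data.List.Relation.Unary.All using (All; []; _∷_)
  renaming (map to all-map; tabulate to all-tabulate; universal to all-universal)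
open import Data.List.Relation.Unary.All.Properties using (++⁻)
open import Data.List.Relation.Unary.Any using (index)
open import Data.List.Relation.Unary.Any.Properties using (lookup-index; mapWith∈⁺)
open import Data.Nat using (ℕ; zero; suc; _+_; _<_; _≤_; s≤s; z≤n)
open import Data.Nat.Properties
  using (+-comm; +-mono-≤; +-monoʳ-≤; m≤n+m; m≤m+n; n<1+n; <-cmp; <⇒≢; +-cancelˡ-≡; +-cancelʳ-≡;
         module ≤-Reasoning)
open import Data.Product using (Σ; _×_; _,_; proj₁; proj₂; map₂)
open import Data.Product.Properties using (,-injectiveˡ; ,-injectiveʳ)
open import Data.Sum using (_⊎_; inj₁; inj₂)
open import Data.Sum.Function.Propositional using (_⊎-↣_)
open import Function using (_∘_)
open import Function.Bundles using (_↣_; _↔_; mk↣; Inverse; Equivalence)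
open import Function.Construct.Composition using (_↣-∘_)
open import Function.Properties.Inverse using (↔⇒↣)
open import Relation.Binary.Definitions using (tri<; tri≈; tri>)
open import Relation.Binary.PropositionalEquality
  using (_≡_; refl; sym; trans; cong; cong₂; subst; subst₂; module ≡-Reasoning)

triangle : ℕ → ℕ
triangle zero    = 0
triangle (suc k) = suc k + triangle k

triangle-mono-≤ : ∀ {k l} → k ≤ l → triangle k ≤ triangle l
triangle-mono-≤ {l = l} z≤n     = z≤n
triangle-mono-≤         (s≤s p) = +-mono-≤ (s≤s p) (triangle-mono-≤ p)

cantor : ℕ × ℕ → ℕ
cantor (n , j) = triangle (n + j) + j

cantor-<-triangle : ∀ n j → cantor (n , j) < triangle (suc (n + j))
cantor-<-triangle n j = begin-strict
  triangle (n + j) + j        ≤⟨ +-monoʳ-≤ (triangle (n + j)) (m≤n+m j n) ⟩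
  triangle (n + j) + (n + j)  <⟨ n<1+n _ ⟩
  suc (triangle (n + j) + (n + j)) ≡⟨ cong suc (+-comm (triangle (n + j)) (n + j)) ⟩
  triangle (suc (n + j))      ∎
  where open ≤-Reasoning

cantor-mono-< : ∀ n j n′ j′ → n + j < n′ + j′ → cantor (n , j) < cantor (n′ , j′)
cantor-mono-< n j n′ j′ lt = begin-strict
  cantor (n , j)            <⟨ cantor-<-triangle n j ⟩
  triangle (suc (n + j))    ≤⟨ triangle-mono-≤ lt ⟩
  triangle (n′ + j′)        ≤⟨ m≤m+n _ j′ ⟩
  cantor (n′ , j′)          ∎
  where open ≤-Reasoning

cantor-injective : ∀ {p q} → cantor p ≡ cantor q → p ≡ q
cantor-injective {n , j} {n′ , j′} eq with <-cmp (n + j) (n′ + j′)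
... | tri< lt _ _ = ⊥-elim (<⇒≢ (cantor-mono-< n j n′ j′ lt) eq)
... | tri> _ _ gt = ⊥-elim (<⇒≢ (cantor-mono-< n′ j′ n j gt) (sym eq))
... | tri≈ _ same _ = cong₂ _,_ n≡n′ j≡j′
  where
  j≡j′ : j ≡ j′
  j≡j′ = +-cancelˡ-≡ (triangle (n + j)) j j′ (trans eq (cong (λ k → triangle k + j′) (sym same)))
  n≡n′ : n ≡ n′
  n≡n′ = +-cancelʳ-≡ j n n′ (trans same (cong (n′ +_) (sym j≡j′)))

ℕ×ℕ↣ℕ : (ℕ × ℕ) ↣ ℕ
ℕ×ℕ↣ℕ = mk↣ cantor-injective

tag : ℕ ⊎ ℕ → ℕ × ℕ
tag (inj₁ n) = 0 , n
tag (inj₂ n) = 1 , n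

tag-injective : ∀ {x y} → tag x ≡ tag y → x ≡ y
tag-injective {inj₁ _} {inj₁ _} refl = refl
tag-injective {inj₂ _} {inj₂ _} refl = refl

⊎-↣ℕ : ∀ {A B : Set} → A ↣ ℕ → B ↣ ℕ → (A ⊎ B) ↣ ℕ
⊎-↣ℕ A↣ℕ B↣ℕ = ℕ×ℕ↣ℕ ↣-∘ (mk↣ tag-injective ↣-∘ (A↣ℕ ⊎-↣ B↣ℕ))

↔Fin⇒↣ℕ : ∀ {A : Set} {n} → A ↔ Fin n → A ↣ ℕ
↔Fin⇒↣ℕ A↔Fin = mk↣ toℕ-injective ↣-∘ ↔⇒↣ A↔Fin

module _ {X : Set} (xs : ℕ → List X) where

  Position : Set
  Position = Σ ℕ (λ n → Fin (length (xs n)))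

  at : Position → X
  at (n , j) = lookup (xs n) j

  position : ∀ n {x} → x ∈ xs n → Position
  position n x∈ = n , index x∈

  at-position : ∀ n {x} (x∈ : x ∈ xs n) → at (position n x∈) ≡ x
  at-position n x∈ = sym (lookup-index x∈)

  Position↣ℕ : Position ↣ ℕ
  Position↣ℕ = ℕ×ℕ↣ℕ ↣-∘ mk↣ injective
    where
    injective : ∀ {p q} → map₂ toℕ p ≡ map₂ toℕ q → p ≡ q
    injective {n , j} {n′ , j′} eq with ,-injectiveˡ eq
    ... | refl = cong (n ,_) (toℕ-injective (,-injectiveʳ eq))

module _ {T : Pres} where

  ≡⇒∼ : ∀ {u v} → u ≡ v → T ⊢ u ∼ v
  ≡⇒∼ refl = ∼refl

  ∼-++ : ∀ {u u′ v v′} → T ⊢ u ∼ u′ → T ⊢ v ∼ v′ → T ⊢ (u ++ v) ∼ (u′ ++ v′)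
  ∼-++ {u} {u′} {v} {v′} u∼u′ v∼v′ =
    ∼trans (∼ctx [] v u∼u′)
      (subst₂ (T ⊢_∼_) (cong (u′ ++_) (++-identityʳ v)) (cong (u′ ++_) (++-identityʳ v′)) (∼ctx u′ [] v∼v′))

  RelInstance : Set
  RelInstance = Σ (List (Gen T)) λ x → Σ (List (Gen T)) λ y → Rel T x y

  -- The letters of the words and contexts inside a derivation; the letters
  -- of its two endpoints are not included.
  innerLetters : ∀ {u v} → T ⊢ u ∼ v → List (Gen T)
  innerLetters (gen _)              = []
  innerLetters ∼refl                = []
  innerLetters (∼sym d)             = innerLetters d
  innerLetters (∼trans {v = m} d e) = m ++ innerLetters d ++ innerLetters e
  innerLetters (∼ctx x y {u} {v} d) = x ++ y ++ u ++ v ++ innerLetters d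

  usedRelations : ∀ {u v} → T ⊢ u ∼ v → List RelInstance
  usedRelations (gen {u} {v} r) = (u , v , r) ∷ []
  usedRelations ∼refl           = []
  usedRelations (∼sym d)        = usedRelations d
  usedRelations (∼trans d e)    = usedRelations d ++ usedRelations e
  usedRelations (∼ctx _ _ d)    = usedRelations d

concatMap-resp : ∀ {P Q} (h : Gen Q → List (Gen P)) →
  (∀ {u v} → Rel Q u v → P ⊢ concatMap h u ∼ concatMap h v) →
  ∀ {u v} → Q ⊢ u ∼ v → P ⊢ concatMap h u ∼ concatMap h v
concatMap-resp h h-rel (gen r)       = h-rel r
concatMap-resp h h-rel ∼refl         = ∼refl
concatMap-resp h h-rel (∼sym d)      = ∼sym (concatMap-resp h h-rel d)
concatMap-resp h h-rel (∼trans d e)  = ∼trans (concatMap-resp h h-rel d) (concatMap-resp h h-rel e)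
concatMap-resp {P} h h-rel (∼ctx x y {u} {v} d) =
  subst₂ (P ⊢_∼_) (sym (concatMap-++³ u)) (sym (concatMap-++³ v))
    (∼ctx (concatMap h x) (concatMap h y) (concatMap-resp h h-rel d))
  where
  concatMap-++³ : ∀ z → concatMap h (x ++ z ++ y) ≡ concatMap h x ++ concatMap h z ++ concatMap h y
  concatMap-++³ z = trans (concatMap-++ h x (z ++ y)) (cong (concatMap h x ++_) (concatMap-++ h z y))

module IsoInducedProperties {P Q : Pres} {f : Hom P Q} (iso : IsIsoInduced f) where
  open IsIsoInduced iso

  invLetterwise : List (Gen Q) → List (Gen P)
  invLetterwise = concatMap (λ q → inv [ q ])

  invLetterwise∼inv : ∀ u → P ⊢ invLetterwise u ∼ inv u
  invLetterwise∼inv []      = ∼sym inv-unit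
  invLetterwise∼inv (q ∷ u) =
    ∼trans (∼-++ (∼refl {u = inv [ q ]}) (invLetterwise∼inv u)) (∼sym (inv-mult [ q ] u))

  invLetterwise-resp : ∀ {u v} → Q ⊢ u ∼ v → P ⊢ invLetterwise u ∼ invLetterwise v
  invLetterwise-resp {u} {v} d =
    ∼trans (invLetterwise∼inv u) (∼trans (inv-resp d) (∼sym (invLetterwise∼inv v)))

module Lifting {T X : Pres} (emb : Gen X → Gen T) where

  HasPreimage : Gen T → Set
  HasPreimage p = Σ (Gen X) (λ y → emb y ≡ p)

  liftWord : ∀ {ws} → All HasPreimage ws → Σ (List (Gen X)) (λ l → map emb l ≡ ws)
  liftWord []                  = [] , refl
  liftWord ((y , refl) ∷ pre) with liftWord pre
  ... | l , refl = y ∷ l , refl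

  Lifts : List (Gen T) → List (Gen T) → Set
  Lifts s t = ∀ s′ t′ → map emb s′ ≡ s → map emb t′ ≡ t → X ⊢ s′ ∼ t′

  module _ (lifts-refl : ∀ s → Lifts s s) where

    lift : ∀ {s t} (d : T ⊢ s ∼ t) → All HasPreimage (innerLetters d) →
           All (λ (x , y , _) → Lifts x y) (usedRelations d) → Lifts s t
    lift (gen r)   _   (r↑ ∷ []) = r↑
    lift ∼refl     _   _         = lifts-refl _
    lift (∼sym d)  pre rels s′ t′ s′↦ t′↦ = ∼sym (lift d pre rels t′ s′ t′↦ s′↦)
    lift (∼trans {v = m} d e) pre rels s′ t′ s′↦ t′↦
      with ++⁻ m pre
    ... | preₘ , pre′ with ++⁻ (innerLetters d) pre′ | ++⁻ (usedRelations d) rels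
    ... | pre-d , pre-e | rels-d , rels-e with liftWord preₘ
    ... | m′ , refl = ∼trans (lift d pre-d rels-d s′ m′ s′↦ refl) (lift e pre-e rels-e m′ t′ refl t′↦)
    lift (∼ctx x y {u} {v} d) pre rels s′ t′ s′↦ t′↦
      with ++⁻ x pre
    ... | preₓ , pre₁ with ++⁻ y pre₁
    ... | preʸ , pre₂ with ++⁻ u pre₂
    ... | preᵤ , pre₃ with ++⁻ v pre₃
    ... | preᵥ , pre-d with liftWord preₓ | liftWord preʸ | liftWord preᵤ | liftWord preᵥ
    ... | x′ , refl | y′ , refl | u′ , refl | v′ , refl =
      ∼trans (lifts-refl _ s′ (x′ ++ u′ ++ y′) s′↦ (map-++³ x′ u′ y′))
        (∼trans (∼ctx x′ y′ (lift d pre-d rels u′ v′ refl refl))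
                (lifts-refl _ (x′ ++ v′ ++ y′) t′ (map-++³ x′ v′ y′) t′↦))
      where
      map-++³ : ∀ a b c → map emb (a ++ b ++ c) ≡ map emb a ++ map emb b ++ map emb c
      map-++³ a b c = trans (map-++ emb a (b ++ c)) (cong (map emb a ++_) (map-++ emb b c))

enumerate : ∀ {A : Set} {n} → A ↔ Fin n → List A
enumerate A↔Fin = tabulate (Inverse.from A↔Fin)

∈-enumerate : ∀ {A : Set} {n} (A↔Fin : A ↔ Fin n) x → x ∈ enumerate A↔Fin
∈-enumerate A↔Fin x =
  subst (_∈ enumerate A↔Fin) (Inverse.strictlyInverseʳ A↔Fin x) (∈-tabulate⁺ (Inverse.to A↔Fin x))

∈-concatMap : ∀ {A B : Set} (h : A → List B) {x xs y} → x ∈ xs → y ∈ h x → y ∈ concatMap h xs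
∈-concatMap h x∈ y∈ = ∈-concat⁺′ y∈ (∈-map⁺ h x∈)

module Closure (P Q : RPres) (w : Hom (pres P) (pres Q)) (w∈𝒲 : InW w)
    (R S : RPres) (finR : Finite R) (finS : Finite S)
    (i : Hom (pres R) (pres S)) (f : Hom (pres R) (pres P)) (g : Hom (pres S) (pres Q))
    (square : (w ∘H f) ≈H (g ∘H i)) where

  open IsIsoInduced w∈𝒲
  open IsoInducedProperties w∈𝒲

  GP : Set
  GP = Gen (pres P)

  GQ : Set
  GQ = Gen (pres Q)

  left₁ : (p : GP) → pres P ⊢ inv [ fun w p ] ∼ [ p ]
  left₁ p = left [ p ]

  right₁ : (q : GQ) → pres Q ⊢ map (fun w) (inv [ q ]) ∼ [ q ]
  right₁ q = right [ q ]

  inverseLetters : RelInstance {pres Q} → List GP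
  inverseLetters (_ , _ , r) = innerLetters (invLetterwise-resp (gen r))

  neededFor : GQ → List GP
  neededFor q = inv [ q ] ++ concatMap inverseLetters (usedRelations (right₁ q))

  relationsS : List (List (Gen (pres S)) × List (Gen (pres S)))
  relationsS = proj₁ (proj₂ finS)

  gRelation : ∀ {uv} → uv ∈ relationsS → RelInstance {pres Q}
  gRelation {u , v} uv∈ = map (fun g) u , map (fun g) v ,
    resp g u v (Equivalence.from (proj₂ (proj₂ finS) u v) (inj₂ uv∈))

  generatorsR : List (Gen (pres R))
  generatorsR = enumerate (proj₂ (proj₁ finR))

  generatorsS : List (Gen (pres S))
  generatorsS = enumerate (proj₂ (proj₁ finS))

  record Stage : Set where
    field
      As : List GP
      Bs : List GQ

  stage : ℕ → Stage
  stage zero = record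
    { As = map (fun f) generatorsR ++ concatMap inverseLetters (mapWith∈ relationsS gRelation)
    ; Bs = map (fun g) generatorsS }
  stage (suc n) = record
    { As = concatMap (innerLetters ∘ left₁) As ++ concatMap neededFor Bs
    ; Bs = map (fun w) As ++ concatMap (innerLetters ∘ right₁) Bs }
    where open Stage (stage n)

  As : ℕ → List GP
  As = Stage.As ∘ stage

  Bs : ℕ → List GQ
  Bs = Stage.Bs ∘ stage

  InA : GP → Set
  InA p = Σ ℕ λ n → p ∈ As n

  InB : GQ → Set
  InB q = Σ ℕ λ n → q ∈ Bs n

  InA-left : ∀ {p} → InA p → All InA (innerLetters (left₁ p))
  InA-left (n , p∈) = all-tabulate λ x∈ → suc n , ∈-++⁺ˡ (∈-concatMap (innerLetters ∘ left₁) p∈ x∈)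

  InB-inv : ∀ {q} → InB q → All InA (inv [ q ])
  InB-inv (n , q∈) = all-tabulate λ x∈ → suc n , ∈-++⁺ʳ _ (∈-concatMap neededFor q∈ (∈-++⁺ˡ x∈))

  InB-inverseLetters : ∀ {q} → InB q → All (All InA ∘ inverseLetters) (usedRelations (right₁ q))
  InB-inverseLetters {q} (n , q∈) = all-tabulate λ e∈ → all-tabulate λ x∈ →
    suc n , ∈-++⁺ʳ _ (∈-concatMap neededFor q∈ (∈-++⁺ʳ (inv [ q ]) (∈-concatMap inverseLetters e∈ x∈)))

  InB-right : ∀ {q} → InB q → All InB (innerLetters (right₁ q))
  InB-right (n , q∈) = all-tabulate λ y∈ → suc n , ∈-++⁺ʳ _ (∈-concatMap (innerLetters ∘ right₁) q∈ y∈)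

  InA-gRelation : ∀ {uv} (uv∈ : uv ∈ relationsS) → All InA (inverseLetters (gRelation uv∈))
  InA-gRelation uv∈ = all-tabulate λ x∈ →
    zero , ∈-++⁺ʳ _ (∈-concatMap inverseLetters (mapWith∈⁺ gRelation (_ , uv∈ , refl)) x∈)

  A : Set
  A = Gen (pres R) ⊎ Position As

  B : Set
  B = Gen (pres S) ⊎ Position Bs

  a : A → GP
  a (inj₁ r) = fun f r
  a (inj₂ x) = at As x

  b : B → GQ
  b (inj₁ s) = fun g s
  b (inj₂ y) = at Bs y

  w-at∈Bs-suc : ∀ n j → fun w (at As (n , j)) ∈ Bs (suc n)
  w-at∈Bs-suc n j = ∈-++⁺ˡ (∈-map⁺ (fun w) (∈-lookup {xs = As n} j))

  wω : A → B
  wω (inj₁ r)       = inj₁ (fun i r)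
  wω (inj₂ (n , j)) = inj₂ (position Bs (suc n) (w-at∈Bs-suc n j))

  b∘wω : ∀ x → b (wω x) ≡ fun w (a x)
  b∘wω (inj₁ r)       = sym (square r)
  b∘wω (inj₂ (n , j)) = at-position Bs (suc n) (w-at∈Bs-suc n j)

  InA-a : ∀ x → InA (a x)
  InA-a (inj₁ r)       = zero , ∈-++⁺ˡ (∈-map⁺ (fun f) (∈-enumerate (proj₂ (proj₁ finR)) r))
  InA-a (inj₂ (n , j)) = n , ∈-lookup {xs = As n} j

  InB-b : ∀ y → InB (b y)
  InB-b (inj₁ s)       = zero , ∈-map⁺ (fun g) (∈-enumerate (proj₂ (proj₁ finS)) s)
  InB-b (inj₂ (n , j)) = n , ∈-lookup {xs = Bs n} j

  PωPres : Pres
  PωPres = record { Gen = A ; Rel = λ u v → Rel (pres P) (map a u) (map a v) }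

  module LiftP = Lifting {pres P} {PωPres} a

  InA⇒preimage : ∀ {p} → InA p → LiftP.HasPreimage p
  InA⇒preimage (n , p∈) = inj₂ (position As n p∈) , at-position As n p∈

  Pω-lifts : ∀ {x y} → Rel (pres P) x y → LiftP.Lifts x y
  Pω-lifts r u v refl refl = gen r

  liftToPω : ∀ {s t} (d : pres P ⊢ s ∼ t) → All InA (innerLetters d) → LiftP.Lifts s t
  liftToPω d letters = LiftP.lift (λ s → Pω-lifts (isRefl P s)) d (all-map InA⇒preimage letters)
    (all-universal (λ (_ , _ , r) → Pω-lifts r) _)

  liftInv : ∀ y → Σ (List A) (λ l → map a l ≡ inv [ b y ])
  liftInv y = LiftP.liftWord (all-map InA⇒preimage (InB-inv (InB-b y)))

  invω₁ : B → List A
  invω₁ = proj₁ ∘ liftInv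

  map-a-invω₁ : ∀ y → map a (invω₁ y) ≡ inv [ b y ]
  map-a-invω₁ = proj₂ ∘ liftInv

  invω : List B → List A
  invω = concatMap invω₁

  map-a-invω : ∀ u → map a (invω u) ≡ invLetterwise (map b u)
  map-a-invω u = begin
    map a (concatMap invω₁ u)               ≡⟨ map-concatMap a invω₁ u ⟩
    concatMap (map a ∘ invω₁) u             ≡⟨ concatMap-cong map-a-invω₁ u ⟩
    concatMap (λ y → inv [ b y ]) u         ≡⟨ concatMap-map (λ q → inv [ q ]) b u ⟨
    invLetterwise (map b u)                 ∎
    where open ≡-Reasoning

  invω-lifts : ∀ {x y} (d : pres Q ⊢ x ∼ y) → All InA (innerLetters (invLetterwise-resp d)) →
    ∀ u v → map b u ≡ x → map b v ≡ y → PωPres ⊢ invω u ∼ invω v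
  invω-lifts d letters u v refl refl =
    liftToPω (invLetterwise-resp d) letters (invω u) (invω v) (map-a-invω u) (map-a-invω v)

  invω-cong : ∀ u v → map b u ≡ map b v → PωPres ⊢ invω u ∼ invω v
  invω-cong u v eq = Pω-lifts (isRefl P _) (invω u) (invω v)
    (map-a-invω u) (trans (map-a-invω v) (cong invLetterwise (sym eq)))

  QωPres : Pres
  QωPres = record
    { Gen = B
    ; Rel = λ u v → Rel (pres Q) (map b u) (map b v) × PωPres ⊢ invω u ∼ invω v }

  module LiftQ = Lifting {pres Q} {QωPres} b

  InB⇒preimage : ∀ {q} → InB q → LiftQ.HasPreimage q
  InB⇒preimage (n , q∈) = inj₂ (position Bs n q∈) , at-position Bs n q∈

  Qω-lifts-refl : ∀ s → LiftQ.Lifts s s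
  Qω-lifts-refl s u v refl eq =
    gen (subst (Rel (pres Q) (map b u)) (sym eq) (isRefl Q (map b u)) , invω-cong u v (sym eq))

  Qω-lifts : (e : RelInstance {pres Q}) → All InA (inverseLetters e) →
             LiftQ.Lifts (proj₁ e) (proj₁ (proj₂ e))
  Qω-lifts (_ , _ , r) letters u v refl refl = gen (r , invω-lifts (gen r) letters u v refl refl)

  map-b∘wω : ∀ u → map b (map wω u) ≡ map (fun w) (map a u)
  map-b∘wω u = begin
    map b (map wω u)          ≡⟨ map-∘ u ⟨
    map (b ∘ wω) u            ≡⟨ map-cong b∘wω u ⟩
    map (fun w ∘ a) u         ≡⟨ map-∘ u ⟩
    map (fun w) (map a u)     ∎
    where open ≡-Reasoning

  invω-leftInverse : ∀ u → PωPres ⊢ invω (map wω u) ∼ u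
  invω-leftInverse []      = ∼refl
  invω-leftInverse (x ∷ u) = ∼-++ letter (invω-leftInverse u)
    where
    letter : PωPres ⊢ invω₁ (wω x) ∼ [ x ]
    letter = liftToPω (left₁ (a x)) (InA-left (InA-a x)) (invω₁ (wω x)) [ x ]
      (trans (map-a-invω₁ (wω x)) (cong (λ q → inv [ q ]) (b∘wω x))) refl

  invω-rightInverse : ∀ v → QωPres ⊢ map wω (invω v) ∼ v
  invω-rightInverse []      = ∼refl
  invω-rightInverse (y ∷ v) =
    ∼trans (≡⇒∼ (map-++ wω (invω₁ y) (invω v))) (∼-++ letter (invω-rightInverse v))
    where
    letter : QωPres ⊢ map wω (invω₁ y) ∼ [ y ]
    letter = LiftQ.lift Qω-lifts-refl (right₁ (b y))
      (all-map InB⇒preimage (InB-right (InB-b y)))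
      (all-map (λ {e} → Qω-lifts e) (InB-inverseLetters (InB-b y)))
      (map wω (invω₁ y)) [ y ] (trans (map-b∘wω (invω₁ y)) (cong (map (fun w)) (map-a-invω₁ y))) refl

  wωHom : Hom PωPres QωPres
  wωHom = record
    { fun  = wω
    ; resp = λ u v r →
        subst₂ (Rel (pres Q)) (sym (map-b∘wω u)) (sym (map-b∘wω v)) (resp w (map a u) (map a v) r) ,
        ∼trans (invω-leftInverse u) (∼trans (gen r) (∼sym (invω-leftInverse v))) }

  wωHom∈𝒲 : InW wωHom
  wωHom∈𝒲 = record
    { inv      = invω
    ; inv-resp = concatMap-resp invω₁ proj₂
    ; inv-unit = ∼refl
    ; inv-mult = λ u v → ≡⇒∼ (concatMap-++ invω₁ u v)
    ; left     = invω-leftInverse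
    ; right    = invω-rightInverse }

  Pω : RPres
  Pω = record { pres = PωPres ; isRefl = λ u → isRefl P (map a u) }

  Qω : RPres
  Qω = record { pres = QωPres ; isRefl = λ u → isRefl Q (map b u) , ∼refl }

  Pω-countable : Countable Pω
  Pω-countable = ⊎-↣ℕ (↔Fin⇒↣ℕ (proj₂ (proj₁ finR))) (Position↣ℕ As)

  Qω-countable : Countable Qω
  Qω-countable = ⊎-↣ℕ (↔Fin⇒↣ℕ (proj₂ (proj₁ finS))) (Position↣ℕ Bs)

  f′ : Hom (pres R) PωPres
  f′ = record
    { fun  = inj₁
    ; resp = λ u v r → subst₂ (Rel (pres P)) (map-∘ u) (map-∘ v) (resp f u v r) }

  f″ : Hom PωPres (pres P)
  f″ = record { fun = a ; resp = λ _ _ r → r }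

  g′ : Hom (pres S) QωPres
  g′ = record
    { fun  = inj₁
    ; resp = λ u v r → subst₂ (Rel (pres Q)) (map-∘ u) (map-∘ v) (resp g u v r) , invω-resp-S u v r }
    where
    invω-resp-S : ∀ u v → Rel (pres S) u v → PωPres ⊢ invω (map inj₁ u) ∼ invω (map inj₁ v)
    invω-resp-S u v r with Equivalence.to (proj₂ (proj₂ finS) u v) r
    ... | inj₁ refl = ∼refl
    ... | inj₂ uv∈  = invω-lifts (gen (proj₂ (proj₂ (gRelation uv∈)))) (InA-gRelation uv∈)
                        (map inj₁ u) (map inj₁ v) (sym (map-∘ u)) (sym (map-∘ v))

  g″ : Hom QωPres (pres Q)
  g″ = record { fun = b ; resp = λ _ _ → proj₁ }

mainTheorem3 : (P Q : RPres) (w : Hom (pres P) (pres Q)) → InW w →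
    (R S : RPres) → Finite R → Finite S →
    (i : Hom (pres R) (pres S)) (f : Hom (pres R) (pres P)) (g : Hom (pres S) (pres Q)) →
    (w ∘H f) ≈H (g ∘H i) →
    Σ RPres (λ Pω → Σ RPres (λ Qω →
      Countable Pω × Countable Qω ×
      Σ (Hom (pres Pω) (pres Qω)) (λ wω → InW wω ×
      Σ (Hom (pres R) (pres Pω)) (λ f′ → Σ (Hom (pres Pω) (pres P)) (λ f″ →
      Σ (Hom (pres S) (pres Qω)) (λ g′ → Σ (Hom (pres Qω) (pres Q)) (λ g″ →
        (f ≈H (f″ ∘H f′)) × (g ≈H (g″ ∘H g′)) ×
        ((wω ∘H f′) ≈H (g′ ∘H i)) × ((w ∘H f″) ≈H (g″ ∘H wω)))))))))
mainTheorem3 P Q w w∈𝒲 R S finR finS i f g square =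
  Pω , Qω , Pω-countable , Qω-countable , wωHom , wωHom∈𝒲 , f′ , f″ , g′ , g″ ,
  (λ _ → refl) , (λ _ → refl) , (λ _ → refl) , (λ x → sym (b∘wω x))
  where open Closure P Q w w∈𝒲 R S finR finS i f g square
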